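{- Let $H$ be a graph, possibly with loops, and let $G$ be an $H$-colored complete graph of order $n$ with $4\le n<9$, such that for every $x\in V(G)$ the graph $G_x$ is a complete $k_x$-partite graph for some $k_x\in\mathbb{N}$. Suppose that (1) for every $x\in V(G)$, $k_x\ge \frac{n+1}{2}$, and (2) $G$ does not contain a cycle of length $4$ with exactly $3$ obstructions. Then each vertex of $G$ is contained in an $H$-cycle of length $4$.
   Context: All graphs are finite; $G$ is simple. An $H$-coloring of $G$ is a function $c:E(G)\to V(H)$; $G$ is then called $H$-colored. A cycle $(v_1,\dots,v_k,v_1)$ of $G$ is an $H$-cycle if $(c(v_1v_2),\dots,c(v_{k-1}v_k),c(v_kv_1),c(v_1v_2))$ is a walk in $H$ (consecutive colors must be adjacent in $H$, where a loop at a color allows that color to be repeated). For a vertex $x$ of $G$, $G_x$ is the graph whose vertex set is the set of edges of $G$ incident with $x$, two distinct such edges $a,b$ being adjacent in $G_x$ iff $c(a)c(b)\in E(H)$. A complete $k$-partite graph is one whose vertex set is partitioned into $k$ nonempty independent sets with all edges between distinct parts present. For a cycle $(x_1,\dots,x_{m},x_1)$, a vertex $x_i$ is an obstruction of it if $c(x_{i-1}x_i)c(x_ix_{i+1})\notin E(H)$ (indices modulo $m$). -}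

module Defs where

open import Data.Nat using (ℕ)
open import Data.Bool using (Bool; T)
open import Data.Fin using (Fin; zero; suc)
open import Data.Product using (Σ; ∃; _×_; _,_)
open import Relation.Nullary using (¬_)
open import Relation.Binary.PropositionalEquality using (_≡_; _≢_)
open import Function.Bundles using (_⇔_)
open import Function.Definitions using (Injective)

record LoopGraph (m : ℕ) : Set where
  field
    adj : Fin m → Fin m → Bool
    adj-sym : ∀ a b → adj a b ≡ adj b a
open LoopGraph public

Adj : ∀ {m} → LoopGraph m → Fin m → Fin m → Set
Adj H a b = T (adj H a b)

-- An H-coloring of the complete graph K_n on Fin n: the edge {x,y} (x ≢ y)
-- gets colour col x y = col y x.  Values on the diagonal are irrelevant.
record Coloring (n m : ℕ) : Set where
  field
    col : Fin n → Fin n → Fin m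
    col-sym : ∀ x y → col x y ≡ col y x
open Coloring public

-- The vertices of G_x are the edges xy
-- with y ≢ x (identified with y).  A partition into k nonempty parts is given
-- by p (only its values on y ≢ x matter); parts are independent and all edges
-- between distinct parts are present: for distinct y, z ≢ x,
-- xy ~ xz in G_x  iff  p y ≢ p z.
CompleteMultipartite : ∀ {n m} → LoopGraph m → Coloring n m → Fin n → ℕ → Set
CompleteMultipartite {n} H c x k =
  Σ (Fin n → Fin k) λ p →
    (∀ (j : Fin k) → ∃ λ y → y ≢ x × p y ≡ j) ×
    (∀ y z → y ≢ x → z ≢ x → y ≢ z →
       (Adj H (col c x y) (col c x z) ⇔ (p y ≢ p z)))

next4 : Fin 4 → Fin 4
next4 zero = suc zero
next4 (suc zero) = suc (suc zero)
next4 (suc (suc zero)) = suc (suc (suc zero))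
next4 (suc (suc (suc zero))) = zero

prev4 : Fin 4 → Fin 4
prev4 zero = suc (suc (suc zero))
prev4 (suc zero) = zero
prev4 (suc (suc zero)) = suc zero
prev4 (suc (suc (suc zero))) = suc (suc zero)

Cycle4 : ℕ → Set
Cycle4 n = Σ (Fin 4 → Fin n) λ v → Injective _≡_ _≡_ v

Obstruction : ∀ {n m} → LoopGraph m → Coloring n m → (Fin 4 → Fin n) → Fin 4 → Set
Obstruction H c v i = ¬ Adj H (col c (v (prev4 i)) (v i)) (col c (v i) (v (next4 i)))

ExactlyThreeObstructions : ∀ {n m} → LoopGraph m → Coloring n m → (Fin 4 → Fin n) → Set
ExactlyThreeObstructions H c v =
  ∃ λ j → ¬ Obstruction H c v j × (∀ i → i ≢ j → Obstruction H c v i)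

IsHCycle : ∀ {n m} → LoopGraph m → Coloring n m → (Fin 4 → Fin n) → Set
IsHCycle H c v = ∀ i → Adj H (col c (v (prev4 i)) (v i)) (col c (v i) (v (next4 i)))

-- At every vertex v the edges vy fall into the k_v parts of G_v, and two of
-- them are adjacent in H exactly when they lie in different parts, so x a b d x
-- is an H-cycle iff each of its vertices sees its two cycle neighbours in
-- different parts.  Suppose no such cycle passes through x.  For b ≠ x count
-- the mates of b (the y ≠ x lying in the part of x at b) and the vertices v at
-- which b is a mate; by double counting the two totals agree.  The vertices
-- separating b from x (seeing b and x in different parts) pairwise either lie in
-- the same part at x or in the same part at b, hence all lie in one part at x
-- or all in one part at b.  A vertex v has at most as many parts as there are
-- vertices ≠ v outside a set each of whose members shares its part with such a
-- vertex; with at least (n + 1) / 2 parts at every vertex this forces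
-- mates b ≤ matedBy b, strictly for a suitable b, contradicting double counting.

module Submission where

open import Defs
open import Data.Nat using (ℕ; zero; suc; _+_; _*_; _≤_; _<_; z≤n; s≤s; s≤s⁻¹)
open import Data.Nat.Properties hiding (_≟_; suc-injective; 0≢1+n)
open import Data.Nat.Tactic.RingSolver using (solve)
open import Data.List using ([]; _∷_)
open import Data.Fin using (Fin; zero; suc; _≟_; fromℕ<)
open import Data.Fin.Properties using (any?; suc-injective; 0≢1+n)
open import Data.Product using (Σ; ∃; _×_; _,_; proj₁; proj₂)
open import Data.Sum using (_⊎_; inj₁; inj₂; [_,_])
open import Data.Empty using (⊥; ⊥-elim)
open import Function using (case_of_)
open import Function.Bundles using (Equivalence)
open import Function.Definitions using (Injective)
open import Relation.Nullary using (¬_; Dec; yes; no; ¬?; _×-dec_)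
open import Relation.Nullary.Decidable using (decidable-stable)
open import Relation.Unary using (Pred; Decidable; _⊆_; ∁)
open import Relation.Unary.Properties using (_∪?_; _∩?_; ∁?)
open import Relation.Binary.PropositionalEquality
  using (_≡_; _≢_; refl; sym; trans; cong; cong₂; subst; ≢-sym; module ≡-Reasoning)
open import Algebra.Properties.CommutativeMonoid.Sum +-0-commutativeMonoid
  using (sum; sum-syntax; ∑-distrib-+; ∑-comm; sum-cong-≗)
open import Level using (0ℓ)

ind : {A : Set} → Dec A → ℕ
ind (yes _) = 1
ind (no _) = 0

ind-yes : {A : Set} (a? : Dec A) → A → ind a? ≡ 1
ind-yes (yes _) _ = refl
ind-yes (no ¬a) a = ⊥-elim (¬a a)

ind-no : {A : Set} (a? : Dec A) → ¬ A → ind a? ≡ 0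
ind-no (yes a) ¬a = ⊥-elim (¬a a)
ind-no (no _) _ = refl

ind-mono : {A B : Set} (a? : Dec A) (b? : Dec B) → (A → B) → ind a? ≤ ind b?
ind-mono (no _) _ _ = z≤n
ind-mono (yes a) b? f = ≤-reflexive (sym (ind-yes b? (f a)))

ind-cong : {A B : Set} (a? : Dec A) (b? : Dec B) → (A → B) → (B → A) → ind a? ≡ ind b?
ind-cong a? b? f g = ≤-antisym (ind-mono a? b? f) (ind-mono b? a? g)

ind-⊎ : {A B : Set} (a? : Dec A) (b? : Dec B) (c? : Dec (A ⊎ B)) → (A → ¬ B) → ind c? ≡ ind a? + ind b?
ind-⊎ (yes a) b? c? disjoint = trans (ind-yes c? (inj₁ a)) (cong suc (sym (ind-no b? (disjoint a))))
ind-⊎ (no _) (yes b) c? _ = ind-yes c? (inj₂ b)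
ind-⊎ (no ¬a) (no ¬b) c? _ = ind-no c? [ ¬a , ¬b ]

ind-¬ : {A : Set} (a? : Dec A) (b? : Dec (¬ A)) → ind a? + ind b? ≡ 1
ind-¬ (yes a) b? = cong suc (ind-no b? (λ ¬a → ¬a a))
ind-¬ (no ¬a) b? = ind-yes b? ¬a

ind-split : {A B : Set} (a? : Dec A) (b? : Dec B) (c? : Dec (A × ¬ B)) → (B → A) → ind a? ≡ ind c? + ind b?
ind-split a? (yes b) c? B⇒A = trans (ind-yes a? (B⇒A b)) (cong (_+ 1) (sym (ind-no c? (λ (_ , ¬b) → ¬b b))))
ind-split a? (no ¬b) c? _ = trans (ind-cong a? c? (_, ¬b) proj₁) (sym (+-identityʳ _))

∑-mono-≤ : ∀ {n} {f g : Fin n → ℕ} → (∀ i → f i ≤ g i) → ∑[ i < n ] f i ≤ ∑[ i < n ] g i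
∑-mono-≤ {zero} _ = z≤n
∑-mono-≤ {suc n} f≤g = +-mono-≤ (f≤g zero) (∑-mono-≤ (λ i → f≤g (suc i)))

∑-mono-< : ∀ {n} {f g : Fin n → ℕ} → (∀ i → f i ≤ g i) → ∀ i → f i < g i →
           ∑[ i < n ] f i < ∑[ i < n ] g i
∑-mono-< {suc n} f≤g zero fi<gi = +-mono-<-≤ fi<gi (∑-mono-≤ (λ i → f≤g (suc i)))
∑-mono-< {suc n} f≤g (suc i) fi<gi = +-mono-≤-< (f≤g zero) (∑-mono-< (λ i → f≤g (suc i)) i fi<gi)

∑-const-1 : ∀ n → ∑[ i < n ] 1 ≡ n
∑-const-1 zero = refl
∑-const-1 (suc n) = cong suc (∑-const-1 n)

count : ∀ {n} {P : Pred (Fin n) 0ℓ} → Decidable P → ℕ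
count {n} P? = ∑[ i < n ] ind (P? i)

count-mono : ∀ {n} {P Q : Pred (Fin n) 0ℓ} (P? : Decidable P) (Q? : Decidable Q) →
             P ⊆ Q → count P? ≤ count Q?
count-mono P? Q? P⊆Q = ∑-mono-≤ (λ i → ind-mono (P? i) (Q? i) P⊆Q)

count-empty : ∀ {n} {P : Pred (Fin n) 0ℓ} (P? : Decidable P) → (∀ i → ¬ P i) → count P? ≡ 0
count-empty {n} P? ¬P = trans (sum-cong-≗ (λ i → ind-no (P? i) (¬P i))) (∑-const-0 n)
  where
  ∑-const-0 : ∀ m → ∑[ i < m ] 0 ≡ 0
  ∑-const-0 zero = refl
  ∑-const-0 (suc m) = ∑-const-0 m

count-≟ : ∀ {n} (a : Fin n) → count (_≟ a) ≡ 1
count-≟ {suc n} zero = cong suc (count-empty {n} (λ i → suc i ≟ zero) (λ i ()))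
count-≟ (suc a) = trans (sum-cong-≗ (λ i → ind-cong (suc i ≟ suc a) (i ≟ a) suc-injective (cong suc)))
                        (count-≟ a)

count-∪ : ∀ {n} {P Q : Pred (Fin n) 0ℓ} (P? : Decidable P) (Q? : Decidable Q) →
          (∀ {i} → P i → ¬ Q i) → count (P? ∪? Q?) ≡ count P? + count Q?
count-∪ P? Q? disjoint = trans (sum-cong-≗ (λ i → ind-⊎ (P? i) (Q? i) ((P? ∪? Q?) i) disjoint))
                               (∑-distrib-+ (λ i → ind (P? i)) (λ i → ind (Q? i)))

count-insert : ∀ {n} {P : Pred (Fin n) 0ℓ} (P? : Decidable P) {a : Fin n} → ¬ P a →
               count ((_≟ a) ∪? P?) ≡ suc (count P?)
count-insert P? {a} ¬Pa =
  trans (count-∪ (_≟ a) P? (λ { refl → ¬Pa })) (cong (_+ count P?) (count-≟ a))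

count+count-∁ : ∀ {n} {P : Pred (Fin n) 0ℓ} (P? : Decidable P) → count P? + count (∁? P?) ≡ n
count+count-∁ {n} P? = begin
  count P? + count (∁? P?)          ≡⟨ ∑-distrib-+ (λ i → ind (P? i)) (λ i → ind (∁? P? i)) ⟨
  ∑[ i < n ] (ind (P? i) + ind (∁? P? i)) ≡⟨ sum-cong-≗ (λ i → ind-¬ (P? i) (∁? P? i)) ⟩
  ∑[ i < n ] 1                       ≡⟨ ∑-const-1 n ⟩
  n                                 ∎
  where open ≡-Reasoning

count-remove : ∀ {n} {P : Pred (Fin n) 0ℓ} (P? : Decidable P) {a : Fin n} → P a →
               count P? ≡ suc (count (P? ∩? ∁? (_≟ a)))
count-remove {n} P? {a} pa = begin
  count P?                                   ≡⟨ sum-cong-≗ (λ i → ind-split (P? i) (i ≟ a) (Others? i) (λ { refl → pa })) ⟩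
  ∑[ i < n ] (ind (Others? i) + ind (i ≟ a)) ≡⟨ ∑-distrib-+ (λ i → ind (Others? i)) (λ i → ind (i ≟ a)) ⟩
  count Others? + count (_≟ a)              ≡⟨ cong (count Others? +_) (count-≟ a) ⟩
  count Others? + 1                         ≡⟨ +-comm _ 1 ⟩
  suc (count Others?)                       ∎
  where
  open ≡-Reasoning
  Others? = P? ∩? ∁? (_≟ a)

count-injective : ∀ {n k} {P : Pred (Fin n) 0ℓ} (P? : Decidable P) (f : Fin k → Fin n) →
                  Injective _≡_ _≡_ f → (∀ j → P (f j)) → k ≤ count P?
count-injective {k = zero} P? f f-inj Pf = z≤n
count-injective {k = suc k} P? f f-inj Pf = begin
  suc k                                 ≤⟨ s≤s (count-injective (P? ∩? ∁? (_≟ f zero)) (λ j → f (suc j))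
                                              (λ eq → suc-injective (f-inj eq))
                                              (λ j → Pf (suc j) , λ eq → 0≢1+n (sym (f-inj eq)))) ⟩
  suc (count (P? ∩? ∁? (_≟ f zero)))     ≡⟨ count-remove P? (Pf zero) ⟨
  count P?                              ∎
  where open ≤-Reasoning

count≤1 : ∀ {n} {P : Pred (Fin n) 0ℓ} (P? : Decidable P) →
          (∀ {a b} → P a → P b → a ≡ b) → count P? ≤ 1
count≤1 P? unique with any? P?
... | yes (a , pa) = ≤-trans (count-mono P? (_≟ a) (λ pi → unique pi pa)) (≤-reflexive (count-≟ a))
... | no none = ≤-trans (≤-reflexive (count-empty P? (λ i pi → none (i , pi)))) z≤n

3≤k : ∀ {n k} → 4 ≤ n → n + 1 ≤ 2 * k → 3 ≤ k
3≤k {n} {k} 4≤n n<2k = ≮⇒≥ λ k<3 → <-irrefl refl (begin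
  5           ≤⟨ +-monoˡ-≤ 1 4≤n ⟩
  n + 1       ≤⟨ n<2k ⟩
  2 * k       ≤⟨ *-monoʳ-≤ 2 (s≤s⁻¹ k<3) ⟩
  4           ∎)
  where open ≤-Reasoning

n+1≤k+k′ : ∀ {n k k′} → n + 1 ≤ 2 * k → n + 1 ≤ 2 * k′ → n + 1 ≤ k + k′
n+1≤k+k′ {n} {k} {k′} n<2k n<2k′ = *-cancelˡ-≤ 2 (begin
  2 * (n + 1)        ≡⟨ solve (n ∷ []) ⟩
  (n + 1) + (n + 1)  ≤⟨ +-mono-≤ n<2k n<2k′ ⟩
  2 * k + 2 * k′     ≡⟨ *-distribˡ-+ 2 k k′ ⟨
  2 * (k + k′)       ∎)
  where open ≤-Reasoning

two-vertex-slack : ∀ {m s k k′ n} → k′ + s ≤ n → k + m < n → n + 1 ≤ k′ + k → m + s + 2 ≤ n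
two-vertex-slack {m} {s} {k} {k′} {n} k′+s≤n k+m<n n+1≤k′+k = +-cancelˡ-≤ n _ _ (begin
  n + (m + s + 2)          ≡⟨ solve (m ∷ s ∷ n ∷ []) ⟩
  (n + 1) + (m + s + 1)    ≤⟨ +-monoˡ-≤ (m + s + 1) n+1≤k′+k ⟩
  (k′ + k) + (m + s + 1)   ≡⟨ solve (m ∷ s ∷ k ∷ k′ ∷ []) ⟩
  (k′ + s) + suc (k + m)   ≤⟨ +-mono-≤ k′+s≤n k+m<n ⟩
  n + n                    ∎)
  where open ≤-Reasoning

one-vertex-slack : ∀ {m k n} → k + m < n → n + 1 ≤ 2 * k → suc (m + m + 2) ≤ n
one-vertex-slack {m} {k} {n} k+m<n n+1≤2k = +-cancelˡ-≤ n _ _ (begin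
  n + suc (m + m + 2)      ≡⟨ solve (m ∷ n ∷ []) ⟩
  (n + 1) + (m + m + 2)    ≤⟨ +-monoˡ-≤ (m + m + 2) n+1≤2k ⟩
  2 * k + (m + m + 2)      ≡⟨ solve (m ∷ k ∷ []) ⟩
  2 * suc (k + m)          ≤⟨ *-monoʳ-≤ 2 k+m<n ⟩
  2 * n                    ≡⟨ solve (n ∷ []) ⟩
  n + n                    ∎)
  where open ≤-Reasoning

module LocalPartitions {n : ℕ} (k : Fin n → ℕ) (p : (v : Fin n) → Fin n → Fin (k v))
  (onto : ∀ v (j : Fin (k v)) → ∃ λ y → y ≢ v × p v y ≡ j) where

  Redundant : Fin n → Pred (Fin n) 0ℓ → Set
  Redundant v R = ∀ {y} → R y → ∃ λ z → z ≢ v × ¬ R z × p v z ≡ p v y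

  Uniform : Fin n → Pred (Fin n) 0ℓ → Set
  Uniform v R = ∀ {y z} → R y → R z → p v y ≡ p v z

  classes+redundant<n : ∀ v {R} (R? : Decidable R) → ¬ R v → Redundant v R → k v + count R? < n
  classes+redundant<n v {R} R? ¬Rv redundant = begin-strict
    k v + count R?                      <⟨ +-monoʳ-< (k v) (n<1+n (count R?)) ⟩
    k v + suc (count R?)                ≤⟨ +-monoˡ-≤ _ (count-injective Outside? f f-injective f-outside) ⟩
    count Outside? + suc (count R?)     ≡⟨ cong (count Outside? +_) (count-insert R? ¬Rv) ⟨
    count Outside? + count ((_≟ v) ∪? R?) ≡⟨ +-comm (count Outside?) _ ⟩
    count ((_≟ v) ∪? R?) + count Outside? ≡⟨ count+count-∁ ((_≟ v) ∪? R?) ⟩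
    n                                   ∎
    where
    open ≤-Reasoning
    Outside? = ∁? ((_≟ v) ∪? R?)
    representative : (j : Fin (k v)) → ∃ λ z → z ≢ v × ¬ R z × p v z ≡ j
    representative j with onto v j
    ... | y , y≢v , py≡j with R? y
    ...   | yes Ry = let (z , z≢v , ¬Rz , pz≡py) = redundant Ry in z , z≢v , ¬Rz , trans pz≡py py≡j
    ...   | no ¬Ry = y , y≢v , ¬Ry , py≡j
    f : Fin (k v) → Fin n
    f j = proj₁ (representative j)
    f-injective : Injective _≡_ _≡_ f
    f-injective {i} {j} fi≡fj = trans (sym (proj₂ (proj₂ (proj₂ (representative i)))))
                                      (trans (cong (p v) fi≡fj) (proj₂ (proj₂ (proj₂ (representative j)))))
    f-outside : ∀ j → ∁ (λ y → y ≡ v ⊎ R y) (f j)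
    f-outside j = let (_ , z≢v , ¬Rz , _) = representative j in [ z≢v , ¬Rz ]

  classes+uniform≤n : ∀ v {R} (R? : Decidable R) {a} → ¬ R v → R a → Uniform v R → k v + count R? ≤ n
  classes+uniform≤n v {R} R? {a} ¬Rv Ra uniform = begin
    k v + count R?                ≡⟨ cong (k v +_) (count-remove R? Ra) ⟩
    k v + suc (count Others?)     ≡⟨ +-suc (k v) _ ⟩
    suc (k v + count Others?)     ≤⟨ classes+redundant<n v Others? (λ (Rv , _) → ¬Rv Rv) redundant ⟩
    n                             ∎
    where
    open ≤-Reasoning
    Others? = R? ∩? ∁? (_≟ a)
    redundant : Redundant v (λ y → R y × y ≢ a)
    redundant (Ry , _) = a , (λ { refl → ¬Rv Ra }) , (λ (_ , a≢a) → a≢a refl) , uniform Ra Ry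

  classes+uniform<n : ∀ v {R} (R? : Decidable R) {a y z} → ¬ R v → R a → Uniform v R →
                      ¬ R y → y ≢ v → z ≢ v → z ≢ y → p v z ≡ p v y → k v + count R? < n
  classes+uniform<n v {R} R? {a} {y} {z} ¬Rv Ra uniform ¬Ry y≢v z≢v z≢y pz≡py = begin-strict
    k v + count R?                    ≡⟨ cong (k v +_) (count-remove R? Ra) ⟩
    k v + suc (count Others?)         ≡⟨ cong (k v +_) (count-insert Others? (λ (Ry , _) → ¬Ry Ry)) ⟨
    k v + count ((_≟ y) ∪? Others?)   <⟨ classes+redundant<n v ((_≟ y) ∪? Others?) ¬R′v redundant ⟩
    n                                 ∎
    where
    open ≤-Reasoning
    Others? = R? ∩? ∁? (_≟ a)
    R′ : Pred (Fin n) 0ℓ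
    R′ w = w ≡ y ⊎ (R w × w ≢ a)
    ¬R′v : ¬ R′ v
    ¬R′v = [ (λ v≡y → y≢v (sym v≡y)) , (λ (Rv , _) → ¬Rv Rv) ]
    a≢v : a ≢ v
    a≢v refl = ¬Rv Ra
    ¬R′a : ¬ R′ a
    ¬R′a = [ (λ { refl → ¬Ry Ra }) , (λ (_ , a≢a) → a≢a refl) ]
    redundant : Redundant v R′
    redundant (inj₂ (Rw , _)) = a , a≢v , ¬R′a , uniform Ra Rw
    redundant (inj₁ refl) with p v a ≟ p v y
    ... | yes pa≡py = a , a≢v , ¬R′a , pa≡py
    ... | no pa≢py = z , z≢v , [ z≢y , (λ (Rz , _) → pa≢py (trans (uniform Ra Rz) pz≡py)) ] , pz≡py

  uniform-or-uniform : ∀ v w {S} (S? : Decidable S) →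
    (∀ {a d} → S a → S d → p v a ≢ p v d → p w a ≡ p w d) → Uniform v S ⊎ Uniform w S
  uniform-or-uniform v w {S} S? forced with any? (λ a → any? (λ d → S? a ×-dec S? d ×-dec ¬? (p v a ≟ p v d)))
  ... | no noPair = inj₁ (λ {a} {d} Sa Sd → decidable-stable (p v a ≟ p v d) (λ pa≢pd → noPair (a , d , Sa , Sd , pa≢pd)))
  ... | yes (a₁ , d₁ , Sa₁ , Sd₁ , pa₁≢pd₁) = inj₂ (λ Sy Sz → trans (≡a₁ Sy) (sym (≡a₁ Sz)))
    where
    ≡a₁ : ∀ {y} → S y → p w y ≡ p w a₁
    ≡a₁ {y} Sy with p v y ≟ p v a₁
    ... | no py≢pa₁ = forced Sy Sa₁ py≢pa₁
    ... | yes py≡pa₁ = trans (forced Sy Sd₁ (λ py≡pd₁ → pa₁≢pd₁ (trans (sym py≡pa₁) py≡pd₁)))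
                             (sym (forced Sa₁ Sd₁ pa₁≢pd₁))

module FourCycleThrough {n : ℕ} (k : Fin n → ℕ) (p : (v : Fin n) → Fin n → Fin (k v))
  (onto : ∀ v (j : Fin (k v)) → ∃ λ y → y ≢ v × p v y ≡ j)
  (many-classes : ∀ v → n + 1 ≤ 2 * k v) (4≤n : 4 ≤ n) (x : Fin n) where

  open LocalPartitions k p onto

  Mate : Fin n → Pred (Fin n) 0ℓ
  Mate v y = v ≢ x × y ≢ x × y ≢ v × p v y ≡ p v x

  Separator : Fin n → Pred (Fin n) 0ℓ
  Separator b y = y ≢ x × y ≢ b × p y b ≢ p y x

  mate? : ∀ v → Decidable (Mate v)
  mate? v y = ¬? (v ≟ x) ×-dec ¬? (y ≟ x) ×-dec ¬? (y ≟ v) ×-dec (p v y ≟ p v x)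

  separator? : ∀ b → Decidable (Separator b)
  separator? b y = ¬? (y ≟ x) ×-dec ¬? (y ≟ b) ×-dec ¬? (p y b ≟ p y x)

  mates matedBy separators : Fin n → ℕ
  mates v = count (mate? v)
  matedBy y = count (λ v → mate? v y)
  separators b = count (separator? b)

  -- The 4-cycle x a b d x with each vertex seeing its two neighbours in different parts;
  -- the conditions at a and d are Separator b a and Separator b d.
  CrossingCycle : Fin n → Fin n → Fin n → Set
  CrossingCycle a b d = b ≢ x × Separator b a × Separator b d × p x a ≢ p x d × p b a ≢ p b d

  crossingCycle? : Dec (∃ λ a → ∃ λ b → ∃ λ d → CrossingCycle a b d)
  crossingCycle? = any? λ a → any? λ b → any? λ d →
    ¬? (b ≟ x) ×-dec separator? b a ×-dec separator? b d ×-dec ¬? (p x a ≟ p x d) ×-dec ¬? (p b a ≟ p b d)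

  ∑mates≡∑matedBy : ∑[ v < n ] mates v ≡ ∑[ y < n ] matedBy y
  ∑mates≡∑matedBy = ∑-comm (λ v y → ind (mate? v y))

  mates-x≡0 : mates x ≡ 0
  mates-x≡0 = count-empty (mate? x) (λ y (x≢x , _) → x≢x refl)

  classes+mates<n : ∀ {b} → b ≢ x → k b + mates b < n
  classes+mates<n {b} b≢x = classes+redundant<n b (mate? b) (λ (_ , _ , b≢b , _) → b≢b refl)
    (λ (_ , _ , _ , py≡px) → x , (λ x≡b → b≢x (sym x≡b)) , (λ (_ , x≢x , _) → x≢x refl) , sym py≡px)

  separators+matedBy+2≡n : ∀ {b} → b ≢ x → separators b + matedBy b + 2 ≡ n
  separators+matedBy+2≡n {b} b≢x = begin
    sum S + sum M + 2                   ≡⟨ +-assoc (sum S + sum M) 1 1 ⟨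
    sum S + sum M + 1 + 1               ≡⟨ cong₂ (λ i j → sum S + sum M + i + j) (count-≟ x) (count-≟ b) ⟨
    sum S + sum M + sum X + sum B       ≡⟨ distrib ⟨
    ∑[ y < n ] (S y + M y + X y + B y)  ≡⟨ sum-cong-≗ pointwise ⟩
    ∑[ y < n ] 1                        ≡⟨ ∑-const-1 n ⟩
    n                                   ∎
    where
    open ≡-Reasoning
    S M X B : Fin n → ℕ
    S y = ind (separator? b y)
    M y = ind (mate? y b)
    X y = ind (y ≟ x)
    B y = ind (y ≟ b)
    distrib : ∑[ y < n ] (S y + M y + X y + B y) ≡ sum S + sum M + sum X + sum B
    distrib = trans (∑-distrib-+ (λ y → S y + M y + X y) B)
             (cong (_+ sum B) (trans (∑-distrib-+ (λ y → S y + M y) X) (cong (_+ sum X) (∑-distrib-+ S M))))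
    pointwise : ∀ y → S y + M y + X y + B y ≡ 1
    pointwise y = cases (y ≟ x) (y ≟ b) (p y b ≟ p y x)
      where
      ind₄ : ∀ {s m x′ b′} → S y ≡ s → M y ≡ m → X y ≡ x′ → B y ≡ b′ →
             S y + M y + X y + B y ≡ s + m + x′ + b′
      ind₄ S≡ M≡ X≡ B≡ = cong₂ _+_ (cong₂ _+_ (cong₂ _+_ S≡ M≡) X≡) B≡
      cases : Dec (y ≡ x) → Dec (y ≡ b) → Dec (p y b ≡ p y x) → S y + M y + X y + B y ≡ 1
      cases (yes y≡x) _ _ = ind₄ (ind-no (separator? b y) (λ (y≢x , _) → y≢x y≡x))
        (ind-no (mate? y b) (λ (y≢x , _) → y≢x y≡x)) (ind-yes (y ≟ x) y≡x)
        (ind-no (y ≟ b) (λ y≡b → b≢x (trans (sym y≡b) y≡x)))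
      cases (no y≢x) (yes y≡b) _ = ind₄ (ind-no (separator? b y) (λ (_ , y≢b , _) → y≢b y≡b))
        (ind-no (mate? y b) (λ (_ , _ , b≢y , _) → b≢y (sym y≡b))) (ind-no (y ≟ x) y≢x) (ind-yes (y ≟ b) y≡b)
      cases (no y≢x) (no y≢b) (yes same) = ind₄ (ind-no (separator? b y) (λ (_ , _ , diff) → diff same))
        (ind-yes (mate? y b) (y≢x , b≢x , (λ b≡y → y≢b (sym b≡y)) , same)) (ind-no (y ≟ x) y≢x) (ind-no (y ≟ b) y≢b)
      cases (no y≢x) (no y≢b) (no diff) = ind₄ (ind-yes (separator? b y) (y≢x , y≢b , diff))
        (ind-no (mate? y b) (λ (_ , _ , _ , same) → diff same)) (ind-no (y ≟ x) y≢x) (ind-no (y ≟ b) y≢b)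

  3≤classes : ∀ v → 3 ≤ k v
  3≤classes v = 3≤k {k = k v} 4≤n (many-classes v)

  n+1≤classes+classes : ∀ v w → n + 1 ≤ k v + k w
  n+1≤classes+classes v w = n+1≤k+k′ {k = k v} {k′ = k w} (many-classes v) (many-classes w)

  ≤matedBy : ∀ {b} → b ≢ x → ∀ m → m + separators b + 2 ≤ n → m ≤ matedBy b
  ≤matedBy {b} b≢x m m+s+2≤n = +-cancelˡ-≤ (separators b) m (matedBy b) (begin
    separators b + m             ≡⟨ +-comm (separators b) m ⟩
    m + separators b             ≤⟨ +-cancelʳ-≤ 2 _ _ (subst (m + separators b + 2 ≤_)
                                      (sym (separators+matedBy+2≡n b≢x)) m+s+2≤n) ⟩
    separators b + matedBy b     ∎)
    where open ≤-Reasoning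

  x∉Separator : ∀ {b} → ¬ Separator b x
  x∉Separator (x≢x , _) = x≢x refl

  b∉Separator : ∀ {b} → ¬ Separator b b
  b∉Separator (_ , b≢b , _) = b≢b refl

  classes+separators+mates≤n : ∀ {b a} → b ≢ x → Uniform b (Separator b) → Separator b a →
    (∀ {y} → Separator b y → p b y ≢ p b x) → k b + (separators b + mates b) ≤ n
  classes+separators+mates≤n {b} {a} b≢x uniform Sa apart = begin
    k b + (separators b + mates b)         ≡⟨ cong (λ s → k b + (s + mates b)) (count-remove (separator? b) Sa) ⟩
    k b + suc (count Others? + mates b)    ≡⟨ cong (λ c → k b + suc c) (count-∪ Others? (mate? b) disjoint) ⟨
    k b + suc (count (Others? ∪? mate? b)) ≡⟨ +-suc (k b) _ ⟩
    suc (k b + count (Others? ∪? mate? b)) ≤⟨ classes+redundant<n b (Others? ∪? mate? b) ¬Rb redundant ⟩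
    n                                      ∎
    where
    open ≤-Reasoning
    Others? = separator? b ∩? ∁? (_≟ a)
    R : Pred (Fin n) 0ℓ
    R y = (Separator b y × y ≢ a) ⊎ Mate b y
    disjoint : ∀ {y} → Separator b y × y ≢ a → ¬ Mate b y
    disjoint (Sy , _) (_ , _ , _ , py≡px) = apart Sy py≡px
    ¬Rb : ¬ R b
    ¬Rb = [ (λ (Sb , _) → b∉Separator Sb) , (λ (_ , _ , b≢b , _) → b≢b refl) ]
    ¬Ra : ¬ R a
    ¬Ra = [ (λ (_ , a≢a) → a≢a refl) , (λ (_ , _ , _ , pa≡px) → apart Sa pa≡px) ]
    ¬Rx : ¬ R x
    ¬Rx = [ (λ (Sx , _) → x∉Separator Sx) , (λ (_ , x≢x , _) → x≢x refl) ]
    redundant : Redundant b R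
    redundant (inj₁ (Sy , _)) = a , (λ { refl → b∉Separator Sa }) , ¬Ra , uniform Sa Sy
    redundant (inj₂ (_ , _ , _ , py≡px)) = x , (λ x≡b → b≢x (sym x≡b)) , ¬Rx , sym py≡px

  few-separators⇒< : ∀ {b} → b ≢ x → separators b ≤ 1 → mates b < matedBy b
  few-separators⇒< {b} b≢x s≤1 = ≤matedBy b≢x (suc (mates b)) (begin
    suc (mates b + separators b + 2)  ≤⟨ s≤s (+-monoˡ-≤ 2 (+-monoʳ-≤ (mates b) s≤1)) ⟩
    suc (mates b + 1 + 2)             ≡⟨ cong suc (trans (+-assoc (mates b) 1 2) (+-comm (mates b) 3)) ⟩
    suc (3 + mates b)                 ≤⟨ s≤s (+-monoˡ-≤ (mates b) (3≤classes b)) ⟩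
    suc (k b + mates b)               ≤⟨ classes+mates<n b≢x ⟩
    n                                 ∎)
    where open ≤-Reasoning

  no-separators⇒< : ∀ {b} → b ≢ x → ¬ (∃ (Separator b)) → mates b < matedBy b
  no-separators⇒< {b} b≢x none = few-separators⇒< b≢x (count≤1 (separator? b) (λ Sa _ → ⊥-elim (none (_ , Sa))))

  x-uniform⇒≤ : ∀ {b} → b ≢ x → Uniform x (Separator b) → mates b ≤ matedBy b
  x-uniform⇒≤ {b} b≢x uniform with any? (separator? b)
  ... | no none = <⇒≤ (no-separators⇒< b≢x none)
  ... | yes (a , Sa) = ≤matedBy b≢x (mates b) (two-vertex-slack {mates b} {separators b}
          (classes+uniform≤n x (separator? b) x∉Separator Sa uniform)
          (classes+mates<n b≢x) (n+1≤classes+classes x b))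

  x-uniform⇒< : ∀ {y z} → y ≢ x → z ≢ x → z ≢ y → p x z ≡ p x y → Uniform x (Separator y) →
                mates y < matedBy y
  x-uniform⇒< {y} {z} y≢x z≢x z≢y pz≡py uniform with any? (separator? y)
  ... | no none = no-separators⇒< y≢x none
  ... | yes (a , Sa) = ≤matedBy y≢x (suc (mates y)) (begin
          suc (mates y + separators y) + 2  ≡⟨ cong (_+ 2) (+-suc (mates y) (separators y)) ⟨
          mates y + suc (separators y) + 2  ≤⟨ two-vertex-slack {mates y} {suc (separators y)}
                                                 classes+separators<n (classes+mates<n y≢x) (n+1≤classes+classes x y) ⟩
          n                                 ∎)
    where
    open ≤-Reasoning
    classes+separators<n : k x + suc (separators y) ≤ n
    classes+separators<n = subst (_≤ n) (sym (+-suc (k x) (separators y)))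
      (classes+uniform<n x (separator? y) x∉Separator Sa uniform b∉Separator y≢x z≢x z≢y pz≡py)

  b-uniform⇒< : ∀ {b} → b ≢ x → Uniform b (Separator b) → mates b < matedBy b
  b-uniform⇒< {b} b≢x uniform with any? (separator? b)
  ... | no none = no-separators⇒< b≢x none
  ... | yes (a , Sa) with any? (λ y → separator? b y ×-dec (p b y ≟ p b x))
  ...   | yes (y , Sy , py≡px) = ≤matedBy b≢x (suc (mates b)) (begin
          suc (mates b + separators b + 2)  ≤⟨ s≤s (+-monoˡ-≤ 2 (+-monoʳ-≤ (mates b) separators≤mates)) ⟩
          suc (mates b + mates b + 2)       ≤⟨ one-vertex-slack {mates b} {k b} (classes+mates<n b≢x) (many-classes b) ⟩
          n                                 ∎)
    where
    open ≤-Reasoning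
    separators≤mates : separators b ≤ mates b
    separators≤mates = count-mono (separator? b) (mate? b)
      (λ {w} Sw@(w≢x , w≢b , _) → b≢x , w≢x , w≢b , trans (uniform Sw Sy) py≡px)
  ...   | no none = ≤matedBy b≢x (suc (mates b)) (begin
          suc (mates b + separators b + 2)  ≡⟨ cong suc (+-comm (mates b + separators b) 2) ⟩
          3 + (mates b + separators b)      ≡⟨ cong (3 +_) (+-comm (mates b) (separators b)) ⟩
          3 + (separators b + mates b)      ≤⟨ +-monoˡ-≤ _ (3≤classes b) ⟩
          k b + (separators b + mates b)    ≤⟨ classes+separators+mates≤n b≢x uniform Sa
                                                 (λ Sy py≡px → none (_ , Sy , py≡px)) ⟩
          n                                 ∎)
    where open ≤-Reasoning

  module _ (noCycle : ¬ (∃ λ a → ∃ λ b → ∃ λ d → CrossingCycle a b d)) where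

    forced : ∀ {b} → b ≢ x → ∀ {a d} → Separator b a → Separator b d → p x a ≢ p x d → p b a ≡ p b d
    forced {b} b≢x {a} {d} Sa Sd pxa≢pxd = decidable-stable (p b a ≟ p b d)
      (λ pba≢pbd → noCycle (a , b , d , b≢x , Sa , Sd , pxa≢pxd , pba≢pbd))

    x-or-b-uniform : ∀ {b} → b ≢ x → Uniform x (Separator b) ⊎ Uniform b (Separator b)
    x-or-b-uniform {b} b≢x = uniform-or-uniform x b (separator? b) (forced b≢x)

    mates≤matedBy : ∀ b → mates b ≤ matedBy b
    mates≤matedBy b = by-cases (b ≟ x)
      where
      by-cases : Dec (b ≡ x) → mates b ≤ matedBy b
      by-cases (yes b≡x) = subst (λ v → mates v ≤ matedBy v) (sym b≡x) (subst (_≤ matedBy x) (sym mates-x≡0) z≤n)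
      by-cases (no b≢x) = case x-or-b-uniform b≢x of λ where
        (inj₁ x-uniform) → x-uniform⇒≤ b≢x x-uniform
        (inj₂ b-uniform) → <⇒≤ (b-uniform⇒< b≢x b-uniform)

    mates<matedBy : ∃ λ b → mates b < matedBy b
    mates<matedBy with any? (λ y → any? λ z →
                           ¬? (y ≟ x) ×-dec ¬? (z ≟ x) ×-dec ¬? (z ≟ y) ×-dec (p x z ≟ p x y))
    ... | yes (y , z , y≢x , z≢x , z≢y , pz≡py) =
          y , (case x-or-b-uniform y≢x of λ where
                 (inj₁ x-uniform) → x-uniform⇒< y≢x z≢x z≢y pz≡py x-uniform
                 (inj₂ b-uniform) → b-uniform⇒< y≢x b-uniform)
    ... | no singletons = b , (case x-or-b-uniform b≢x of λ where
          (inj₁ x-uniform) → few-separators⇒< b≢x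
                                (count≤1 (separator? b) (λ Sa Sd → injective Sa Sd (x-uniform Sa Sd)))
          (inj₂ b-uniform) → b-uniform⇒< b≢x b-uniform)
      where
      some-class : Fin (k x)
      some-class = fromℕ< (≤-trans (s≤s z≤n) (3≤classes x))
      b : Fin n
      b = proj₁ (onto x some-class)
      b≢x : b ≢ x
      b≢x = proj₁ (proj₂ (onto x some-class))
      injective : ∀ {a d} → Separator b a → Separator b d → p x a ≡ p x d → a ≡ d
      injective {a} {d} (a≢x , _) (d≢x , _) pa≡pd =
        decidable-stable (a ≟ d) (λ a≢d → singletons (d , a , d≢x , a≢x , a≢d , pa≡pd))

    impossible : ⊥
    impossible = <-irrefl ∑mates≡∑matedBy (∑-mono-< mates≤matedBy (proj₁ mates<matedBy) (proj₂ mates<matedBy))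

  crossingCycle : ∃ λ a → ∃ λ b → ∃ λ d → CrossingCycle a b d
  crossingCycle = decidable-stable crossingCycle? impossible

square : ∀ {A : Set} → A → A → A → A → Fin 4 → A
square w x y z zero = w
square w x y z (suc zero) = x
square w x y z (suc (suc zero)) = y
square w x y z (suc (suc (suc zero))) = z

square-injective : ∀ {A : Set} {w x y z : A} → w ≢ x → w ≢ y → w ≢ z → x ≢ y → x ≢ z → y ≢ z →
                   Injective _≡_ _≡_ (square w x y z)
square-injective w≢x w≢y w≢z x≢y x≢z y≢z = injective
  where
  injective : Injective _≡_ _≡_ _
  injective {zero} {zero} _ = refl
  injective {zero} {suc zero} w≡x = ⊥-elim (w≢x w≡x)
  injective {zero} {suc (suc zero)} w≡y = ⊥-elim (w≢y w≡y)
  injective {zero} {suc (suc (suc zero))} w≡z = ⊥-elim (w≢z w≡z)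
  injective {suc zero} {zero} x≡w = ⊥-elim (w≢x (sym x≡w))
  injective {suc zero} {suc zero} _ = refl
  injective {suc zero} {suc (suc zero)} x≡y = ⊥-elim (x≢y x≡y)
  injective {suc zero} {suc (suc (suc zero))} x≡z = ⊥-elim (x≢z x≡z)
  injective {suc (suc zero)} {zero} y≡w = ⊥-elim (w≢y (sym y≡w))
  injective {suc (suc zero)} {suc zero} y≡x = ⊥-elim (x≢y (sym y≡x))
  injective {suc (suc zero)} {suc (suc zero)} _ = refl
  injective {suc (suc zero)} {suc (suc (suc zero))} y≡z = ⊥-elim (y≢z y≡z)
  injective {suc (suc (suc zero))} {zero} z≡w = ⊥-elim (w≢z (sym z≡w))
  injective {suc (suc (suc zero))} {suc zero} z≡x = ⊥-elim (x≢z (sym z≡x))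
  injective {suc (suc (suc zero))} {suc (suc zero)} z≡y = ⊥-elim (y≢z (sym z≡y))
  injective {suc (suc (suc zero))} {suc (suc (suc zero))} _ = refl

adjacent-if-apart : ∀ {n m} (H : LoopGraph m) (c : Coloring n m) {v k} (P : CompleteMultipartite H c v k) →
  ∀ {y z} → y ≢ v → z ≢ v → y ≢ z → proj₁ P y ≢ proj₁ P z → Adj H (col c y v) (col c v z)
adjacent-if-apart H c {v} (_ , _ , adjacent⇔apart) {y} {z} y≢v z≢v y≢z py≢pz =
  subst (λ colour → Adj H colour (col c v z)) (col-sym c v y)
        (Equivalence.from (adjacent⇔apart y z y≢v z≢v y≢z) py≢pz)

theorem3 : (n m : ℕ) (H : LoopGraph m) (c : Coloring n m) →
    4 ≤ n → n < 9 →
    (∀ x → Σ ℕ λ k → CompleteMultipartite H c x k × (n + 1 ≤ 2 * k)) →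
    ¬ (Σ (Cycle4 n) λ C → ExactlyThreeObstructions H c (proj₁ C)) →
    ∀ (x : Fin n) → Σ (Cycle4 n) λ C → IsHCycle H c (proj₁ C) × ∃ λ i → proj₁ C i ≡ x
theorem3 n m H c 4≤n _ multipartite _ x = H-cycle-from crossingCycle
  where
  k : Fin n → ℕ
  k v = proj₁ (multipartite v)
  partition : ∀ v → CompleteMultipartite H c v (k v)
  partition v = proj₁ (proj₂ (multipartite v))
  open FourCycleThrough k (λ v → proj₁ (partition v)) (λ v → proj₁ (proj₂ (partition v)))
    (λ v → proj₂ (proj₂ (multipartite v))) 4≤n x
  H-cycle-from : (∃ λ a → ∃ λ b → ∃ λ d → CrossingCycle a b d) →
                 Σ (Cycle4 n) λ C → IsHCycle H c (proj₁ C) × ∃ λ i → proj₁ C i ≡ x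
  H-cycle-from (a , b , d , b≢x , (a≢x , a≢b , pab≢pax) , (d≢x , d≢b , pdb≢pdx) , pxa≢pxd , pba≢pbd) =
    (square x a b d , square-injective (≢-sym a≢x) (≢-sym b≢x) (≢-sym d≢x) a≢b a≢d (≢-sym d≢b)) ,
    H-cycle , zero , refl
    where
    a≢d : a ≢ d
    a≢d a≡d = pxa≢pxd (cong (proj₁ (partition x)) a≡d)
    H-cycle : IsHCycle H c (square x a b d)
    H-cycle zero = adjacent-if-apart H c (partition x) d≢x a≢x (≢-sym a≢d) (≢-sym pxa≢pxd)
    H-cycle (suc zero) = adjacent-if-apart H c (partition a) (≢-sym a≢x) (≢-sym a≢b) (≢-sym b≢x) (≢-sym pab≢pax)
    H-cycle (suc (suc zero)) = adjacent-if-apart H c (partition b) a≢b d≢b a≢d pba≢pbd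
    H-cycle (suc (suc (suc zero))) = adjacent-if-apart H c (partition d) (≢-sym d≢b) (≢-sym d≢x) b≢x pdb≢pdx
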